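{- Let $k \ge 3$. Then the set of length-2 factors of the infinite word $\mathbf{W}^{(k)}$ equals $\mathcal{B}^{(k)}$: $\mathrm{Fac}_2(\mathbf{W}^{(k)})=\mathcal{B}^{(k)}$.
   Context: Words are over the alphabet $\mathbb{N}=\{0,1,2,\dots\}$; $(x.y)$ denotes the length-2 word with letters $x,y$; $\mathrm{Fac}_2(V)$ is the set of length-2 factors of $V$. For $n\in\mathbb{N}$ and a word $W=w_0\cdots w_{m-1}$, $n\oplus W=(w_0+n)\cdots(w_{m-1}+n)$. For $k\ge 2$, $\phi_k$ is the morphism of $\mathbb{N}^*$ defined for $i\in\mathbb{N}$, $0\le j\le k-1$ by $\phi_k(ki+j)=(ki)(ki+j+1)$ if $0\le j\le k-2$ and $\phi_k(ki+k-1)=ki+k$; $\mathbf{W}^{(k)}=\lim_n\phi_k^n(0)$ is its infinite fixed point starting with $0$. Define $\mathcal{B}_1^{(k)}=\{(ki)\oplus(a.k): i\in\mathbb{N}, a\ge1\}$, $\mathcal{B}_2^{(k)}=\{(ki)\oplus(0.b): i\in\mathbb{N}, 1\le b\le k-1\}$, $\mathcal{B}_3^{(k)}=\{(a.0): a\ge1\}$, $\mathcal{B}^{(k)}=\mathcal{B}_1^{(k)}\cup\mathcal{B}_2^{(k)}\cup\mathcal{B}_3^{(k)}$. -}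

module Defs where

open import Data.Nat using (ℕ; zero; suc; _+_; _*_; _∸_; _≤_; NonZero)
open import Data.Nat.DivMod using (_%_)
open import Data.Nat.Properties using (_≟_)
open import Data.List using (List; []; _∷_; concatMap)
open import Data.Product using (Σ; ∃; _×_; _,_)
open import Data.Sum using (_⊎_)
open import Relation.Nullary using (yes; no)
open import Relation.Binary.PropositionalEquality using (_≡_)

-- φ_k on a letter n = k*i + j (0 ≤ j ≤ k-1, i.e. j = n % k, k*i = n ∸ n % k):
--   j ≤ k-2  (equivalently (n+1) % k ≠ 0):  φ_k(n) = (k*i) (n+1)
--   j = k-1  (equivalently (n+1) % k = 0):  φ_k(n) = n+1  ( = k*i + k )
φ : (k : ℕ) → .{{NonZero k}} → ℕ → List ℕ
φ k n with suc n % k ≟ 0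
... | yes _ = suc n ∷ []
... | no  _ = (n ∸ n % k) ∷ suc n ∷ []

φ* : (k : ℕ) → .{{NonZero k}} → List ℕ → List ℕ
φ* k w = concatMap (φ k) w

φIter : (k : ℕ) → .{{NonZero k}} → ℕ → List ℕ
φIter k zero    = 0 ∷ []
φIter k (suc n) = φ* k (φIter k n)

-- i-th letter of a finite word (0 if out of range; never used out of range below)
nth : List ℕ → ℕ → ℕ
nth []       _       = 0
nth (x ∷ w)  zero    = x
nth (x ∷ w)  (suc i) = nth w i

-- The infinite fixed point W^(k) = lim φ_k^n(0), as a function ℕ → ℕ.
-- Since φ_k(0) = 0 1 (k ≥ 2), each φ_k^n(0) is a prefix of φ_k^(n+1)(0) and
-- |φ_k^n(0)| ≥ n+1, so the i-th letter of the limit is the i-th letter of φ_k^(i+1)(0).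
W : (k : ℕ) → .{{NonZero k}} → ℕ → ℕ
W k i = nth (φIter k (suc i)) i

InFac₂ : (k : ℕ) → .{{NonZero k}} → ℕ → ℕ → Set
InFac₂ k x y = ∃ λ p → W k p ≡ x × W k (suc p) ≡ y

InB₁ : ℕ → ℕ → ℕ → Set
InB₁ k x y = ∃ λ i → ∃ λ a → 1 ≤ a × x ≡ k * i + a × y ≡ k * i + k

InB₂ : ℕ → ℕ → ℕ → Set
InB₂ k x y = ∃ λ i → ∃ λ b → 1 ≤ b × b ≤ k ∸ 1 × x ≡ k * i × y ≡ k * i + b

InB₃ : ℕ → ℕ → ℕ → Set
InB₃ k x y = ∃ λ a → 1 ≤ a × x ≡ a × y ≡ 0

InB : ℕ → ℕ → ℕ → Set
InB k x y = InB₁ k x y ⊎ InB₂ k x y ⊎ InB₃ k x y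

{-# OPTIONS --safe #-}
-- A length-2 factor of φ(w) either lies inside the image φ(a) of a single letter, and is
-- then (ki).(ki+b) with 1 ≤ b ≤ k−1, i.e. in B₂; or it straddles the images of a factor
-- (a.b) of w, and since φ(a) always ends with a+1 it is then the shift
-- (a+1).(first letter of φ(b)). B is closed under this shift, so by induction on n every
-- factor of φⁿ(0) lies in B. Conversely, each pair of B₂ occurs because every letter n
-- occurs in φⁿ(0), and every pair of B₁ ∪ B₃ is an iterated shift of a pair of B₂.
-- Finally, φⁿ(0) is a proper prefix of φⁿ⁺¹(0), so the factors of W are exactly those of
-- the words φⁿ(0).
module Submission where

open import Defs
open import Data.Nat using (ℕ; zero; suc; pred; _+_; _*_; _∸_; _≤_; _<_; _≤′_; ≤′-refl; ≤′-step; z≤n; s≤s; NonZero)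
open import Data.Nat.Properties
open import Data.Nat.DivMod using (_/_; _%_; m%n<n; m≡m%n+[m/n]*n; [m+n]%n≡m%n; [m+kn]%n≡m%n; m*n%n≡0; m<n⇒m%n≡m)
open import Data.List using (List; []; _∷_; _++_; _∷ʳ_; length)
open import Data.List.Properties using (++-assoc; ++-identityʳ; length-++; ∷-injectiveˡ; ∷ʳ-injective; concatMap-++)
open import Data.List.Membership.Propositional using (_∈_)
open import Data.List.Membership.Propositional.Properties using (∈-++⁺ʳ; ∈-concatMap⁺)
open import Data.List.Relation.Unary.Any as Any using (here; there)
open import Data.Product using (proj₂; ∃-syntax; ∃₂; _×_; _,_)
open import Data.Sum using (_⊎_; inj₁; inj₂; map₂)
open import Function.Bundles using (_⇔_; mk⇔)
open import Function.Properties.Equivalence using () renaming (trans to ⇔-trans)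
open import Relation.Nullary using (¬_; yes; no; contradiction)
open import Relation.Binary.PropositionalEquality using (_≡_; refl; sym; trans; cong; cong₂; subst; subst₂; module ≡-Reasoning)

data Fac₂ : List ℕ → ℕ → ℕ → Set where
  here  : ∀ {x y w} → Fac₂ (x ∷ y ∷ w) x y
  there : ∀ {x y z w} → Fac₂ w x y → Fac₂ (z ∷ w) x y

fac₂-++⁺ˡ : ∀ {u v x y} → Fac₂ u x y → Fac₂ (u ++ v) x y
fac₂-++⁺ˡ here      = here
fac₂-++⁺ˡ (there f) = there (fac₂-++⁺ˡ f)

fac₂-++⁺ʳ : ∀ u {v x y} → Fac₂ v x y → Fac₂ (u ++ v) x y
fac₂-++⁺ʳ []      f = f
fac₂-++⁺ʳ (z ∷ u) f = there (fac₂-++⁺ʳ u f)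

fac₂-∷ʳ-++-∷ : ∀ s {x y} t → Fac₂ ((s ∷ʳ x) ++ y ∷ t) x y
fac₂-∷ʳ-++-∷ []      t = here
fac₂-∷ʳ-++-∷ (z ∷ s) t = there (fac₂-∷ʳ-++-∷ s t)

fac₂-++⁻ : ∀ u {v x y} → Fac₂ (u ++ v) x y →
           Fac₂ u x y ⊎
           ((∃[ u′ ] u ≡ u′ ∷ʳ x) × (∃[ v′ ] v ≡ y ∷ v′)) ⊎
           Fac₂ v x y
fac₂-++⁻ []           f         = inj₂ (inj₂ f)
fac₂-++⁻ (z ∷ [])     here      = inj₂ (inj₁ (([] , refl) , (_ , refl)))
fac₂-++⁻ (z ∷ [])     (there f) = inj₂ (inj₂ f)
fac₂-++⁻ (z ∷ z′ ∷ u) here      = inj₁ here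
fac₂-++⁻ (z ∷ z′ ∷ u) (there f) with fac₂-++⁻ (z′ ∷ u) f
... | inj₁ g                     = inj₁ (there g)
... | inj₂ (inj₁ ((u′ , e) , v≡)) = inj₂ (inj₁ ((z ∷ u′ , cong (z ∷_) e) , v≡))
... | inj₂ (inj₂ g)              = inj₂ (inj₂ g)

¬fac₂-[_] : ∀ z {x y} → ¬ Fac₂ (z ∷ []) x y
¬fac₂-[ z ] (there ())

fac₂-[_,_]⁻ : ∀ u v {x y} → Fac₂ (u ∷ v ∷ []) x y → x ≡ u × y ≡ v
fac₂-[ u , v ]⁻ here               = refl , refl
fac₂-[ u , v ]⁻ (there (there ()))

nth-++ˡ : ∀ u v {q} → q < length u → nth (u ++ v) q ≡ nth u q
nth-++ˡ (x ∷ u) v {zero}  _         = refl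
nth-++ˡ (x ∷ u) v {suc q} (s≤s q<u) = nth-++ˡ u v q<u

fac₂⇒nth : ∀ {w x y} → Fac₂ w x y →
           ∃[ p ] suc p < length w × nth w p ≡ x × nth w (suc p) ≡ y
fac₂⇒nth here      = 0 , s≤s (s≤s z≤n) , refl , refl
fac₂⇒nth (there f) with fac₂⇒nth f
... | p , p+1<w , refl , refl = suc p , s≤s p+1<w , refl , refl

nth⇒fac₂ : ∀ w p → suc p < length w → Fac₂ w (nth w p) (nth w (suc p))
nth⇒fac₂ (x ∷ y ∷ w) zero    _           = here
nth⇒fac₂ (x ∷ w)     (suc p) (s≤s p+1<w) = there (nth⇒fac₂ w p p+1<w)

module _ (k : ℕ) .{{_ : NonZero k}} where

  ∃-digits : ∀ n → ∃₂ λ i j → j < k × n ≡ k * i + j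
  ∃-digits n = n / k , n % k , m%n<n n k ,
    trans (m≡m%n+[m/n]*n n k) (trans (+-comm (n % k) _) (cong (_+ n % k) (*-comm (n / k) k)))

  [k*i+j]%k≡j : ∀ i {j} → j < k → (k * i + j) % k ≡ j
  [k*i+j]%k≡j i {j} j<k = begin
    (k * i + j) % k ≡⟨ cong (_% k) (trans (+-comm (k * i) j) (cong (j +_) (*-comm k i))) ⟩
    (j + i * k) % k ≡⟨ [m+kn]%n≡m%n j i k ⟩
    j % k           ≡⟨ m<n⇒m%n≡m j<k ⟩
    j               ∎
    where open ≡-Reasoning

  [k*i+k]%k≡0 : ∀ i → (k * i + k) % k ≡ 0
  [k*i+k]%k≡0 i = trans ([m+n]%n≡m%n (k * i) k) (trans (cong (_% k) (*-comm k i)) (m*n%n≡0 i k))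

  suc[k*i+j]≡k*i+k : ∀ i {j} → suc j ≡ k → suc (k * i + j) ≡ k * i + k
  suc[k*i+j]≡k*i+k i {j} j+1≡k = trans (sym (+-suc (k * i) j)) (cong (k * i +_) j+1≡k)

  k*[1+i]≡k*i+k : ∀ i → k * suc i ≡ k * i + k
  k*[1+i]≡k*i+k i = trans (*-suc k i) (+-comm k (k * i))

  φ-low : ∀ {i j} → suc j < k → φ k (k * i + j) ≡ k * i ∷ k * i + suc j ∷ []
  φ-low {i} {j} j+1<k with suc (k * i + j) % k ≟ 0
  ... | yes ≡0 = contradiction (trans (sym [suc[k*i+j]]%k≡suc[j]) ≡0) λ ()
    where
    [suc[k*i+j]]%k≡suc[j] : suc (k * i + j) % k ≡ suc j
    [suc[k*i+j]]%k≡suc[j] = trans (cong (_% k) (sym (+-suc (k * i) j))) ([k*i+j]%k≡j i j+1<k)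
  ... | no _ = cong₂ (λ a b → a ∷ b ∷ []) k*i+j∸j≡k*i (sym (+-suc (k * i) j))
    where
    k*i+j∸j≡k*i : k * i + j ∸ (k * i + j) % k ≡ k * i
    k*i+j∸j≡k*i = trans (cong (k * i + j ∸_) ([k*i+j]%k≡j i (<-trans (n<1+n j) j+1<k)))
                        (m+n∸n≡m (k * i) j)

  φ-top : ∀ {i j} → suc j ≡ k → φ k (k * i + j) ≡ k * i + k ∷ []
  φ-top {i} {j} j+1≡k with suc (k * i + j) % k ≟ 0
  ... | yes _ = cong (_∷ []) (suc[k*i+j]≡k*i+k i j+1≡k)
  ... | no ≢0 = contradiction (trans (cong (_% k) (suc[k*i+j]≡k*i+k i j+1≡k)) ([k*i+k]%k≡0 i)) ≢0

  φ-small : ∀ {j} → suc j < k → φ k j ≡ 0 ∷ suc j ∷ []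
  φ-small {j} j+1<k =
    subst (λ m → φ k (m + j) ≡ m ∷ m + suc j ∷ []) (*-zeroʳ k) (φ-low {0} j+1<k)

  -- Same case split as φ, so that φ-starts-with-head holds by refl.
  φ-head : ℕ → ℕ
  φ-head n with suc n % k ≟ 0
  ... | yes _ = suc n
  ... | no  _ = n ∸ n % k

  φ-starts-with-head : ∀ n → ∃[ t ] φ k n ≡ φ-head n ∷ t
  φ-starts-with-head n with suc n % k ≟ 0
  ... | yes _ = _ , refl
  ... | no  _ = _ , refl

  φ-ends-with-suc : ∀ n → ∃[ s ] φ k n ≡ s ∷ʳ suc n
  φ-ends-with-suc n with suc n % k ≟ 0
  ... | yes _ = [] , refl
  ... | no  _ = n ∸ n % k ∷ [] , refl

  φ-head-≡ : ∀ {n h t} → φ k n ≡ h ∷ t → φ-head n ≡ h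
  φ-head-≡ {n} φn≡h∷t with φ-starts-with-head n
  ... | _ , φn≡head∷_ = ∷-injectiveˡ (trans (sym φn≡head∷_) φn≡h∷t)

  φ-head-low : ∀ i {j} → suc j < k → φ-head (k * i + j) ≡ k * i
  φ-head-low i j+1<k = φ-head-≡ (φ-low j+1<k)

  φ-head-top : ∀ i {j} → suc j ≡ k → φ-head (k * i + j) ≡ k * i + k
  φ-head-top i j+1≡k = φ-head-≡ (φ-top j+1≡k)

  φ-head-small : ∀ {j} → suc j < k → φ-head j ≡ 0
  φ-head-small j+1<k = φ-head-≡ (φ-small j+1<k)

  φ-head-k*i+k : 1 < k → ∀ i → φ-head (k * i + k) ≡ k * i + k
  φ-head-k*i+k 1<k i = begin
    φ-head (k * i + k)     ≡⟨ cong φ-head (sym (trans (+-identityʳ _) (k*[1+i]≡k*i+k i))) ⟩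
    φ-head (k * suc i + 0) ≡⟨ φ-head-low (suc i) 1<k ⟩
    k * suc i              ≡⟨ k*[1+i]≡k*i+k i ⟩
    k * i + k              ∎
    where open ≡-Reasoning

  φ*-head : ∀ b w {y v} → φ* k (b ∷ w) ≡ y ∷ v → y ≡ φ-head b
  φ*-head b w φ*≡y∷v with φ-starts-with-head b
  ... | _ , φb≡head∷t = ∷-injectiveˡ (trans (sym φ*≡y∷v) (cong (_++ φ* k w) φb≡head∷t))

  φ-last : ∀ {a u x} → φ k a ≡ u ∷ʳ x → x ≡ suc a
  φ-last {a} {u} φa≡u∷ʳx with φ-ends-with-suc a
  ... | s , φa≡s∷ʳa+1 = proj₂ (∷ʳ-injective u s (trans (sym φa≡u∷ʳx) φa≡s∷ʳa+1))

  fac₂-φ*⁻ : ∀ w {x y} → Fac₂ (φ* k w) x y →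
             (∃[ a ] Fac₂ (φ k a) x y) ⊎
             (∃₂ λ a b → Fac₂ w a b × x ≡ suc a × y ≡ φ-head b)
  fac₂-φ*⁻ (a ∷ w) {x} f with fac₂-++⁻ (φ k a) f
  ... | inj₁ g        = inj₁ (a , g)
  ... | inj₂ (inj₂ g) =
    map₂ (λ (a′ , b , g′ , eqs) → a′ , b , there g′ , eqs) (fac₂-φ*⁻ w g)
  ... | inj₂ (inj₁ ((_ , φa≡u∷ʳx) , (_ , φ*w≡y∷v))) = inj₂ (straddle w φ*w≡y∷v)
    where
    straddle : ∀ w {y v} → φ* k w ≡ y ∷ v →
               ∃₂ λ a′ b → Fac₂ (a ∷ w) a′ b × x ≡ suc a′ × y ≡ φ-head b
    straddle (b ∷ w) φ*w≡y∷v = a , b , here , φ-last φa≡u∷ʳx , φ*-head b w φ*w≡y∷v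

  fac₂-φ*⁺ : ∀ w {a b} → Fac₂ w a b → Fac₂ (φ* k w) (suc a) (φ-head b)
  fac₂-φ*⁺ (a ∷ b ∷ w) here with φ-ends-with-suc a | φ-starts-with-head b
  ... | s , φa≡s∷ʳa+1 | t , φb≡head∷t =
    subst (λ u → Fac₂ u (suc a) (φ-head b))
          (sym (cong₂ _++_ φa≡s∷ʳa+1 (cong (_++ φ* k w) φb≡head∷t)))
          (fac₂-∷ʳ-++-∷ s (t ++ φ* k w))
  fac₂-φ*⁺ (z ∷ w) (there f) = fac₂-++⁺ʳ (φ k z) (fac₂-φ*⁺ w f)

  fac₂-φ*⁺-inner : ∀ {w a x y} → a ∈ w → Fac₂ (φ k a) x y → Fac₂ (φ* k w) x y
  fac₂-φ*⁺-inner          (here refl) g = fac₂-++⁺ˡ g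
  fac₂-φ*⁺-inner {z ∷ _} (there a∈w) g = fac₂-++⁺ʳ (φ k z) (fac₂-φ*⁺-inner a∈w g)

  suc∈φ : ∀ n → suc n ∈ φ k n
  suc∈φ n with φ-ends-with-suc n
  ... | s , φn≡s∷ʳn+1 = subst (suc n ∈_) (sym φn≡s∷ʳn+1) (∈-++⁺ʳ s (here refl))

  n∈φIter-n : ∀ n → n ∈ φIter k n
  n∈φIter-n zero    = here refl
  n∈φIter-n (suc n) = ∈-concatMap⁺ (φ k) (Any.map (λ { refl → suc∈φ n }) (n∈φIter-n n))

  length-φ* : ∀ w → length w ≤ length (φ* k w)
  length-φ* []      = z≤n
  length-φ* (a ∷ w) with φ-starts-with-head a
  ... | t , φa≡head∷t = begin
    suc (length w)                    ≤⟨ s≤s (length-φ* w) ⟩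
    suc (length (φ* k w))             ≤⟨ s≤s (m≤n+m _ (length t)) ⟩
    suc (length t + length (φ* k w))  ≡⟨ length-++ (φ-head a ∷ t) ⟨
    length ((φ-head a ∷ t) ++ φ* k w) ≡⟨ cong (λ u → length (u ++ φ* k w)) φa≡head∷t ⟨
    length (φ* k (a ∷ w))             ∎
    where open ≤-Reasoning

  fac₂-φ⇒InB₂ : ∀ {a x y} → Fac₂ (φ k a) x y → InB₂ k x y
  fac₂-φ⇒InB₂ {a} f with ∃-digits a
  ... | i , j , j<k , refl with m≤n⇒m<n∨m≡n j<k
  ...   | inj₂ j+1≡k = contradiction (subst (λ w → Fac₂ w _ _) (φ-top j+1≡k) f) ¬fac₂-[ _ ]
  ...   | inj₁ j+1<k with fac₂-[ _ , _ ]⁻ (subst (λ w → Fac₂ w _ _) (φ-low j+1<k) f)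
  ...     | refl , refl = i , suc j , s≤s z≤n , <⇒≤pred j+1<k , refl , refl

  InB-suc[k*i]-k*i : ∀ i → InB k (suc (k * i)) (k * i)
  InB-suc[k*i]-k*i zero    = inj₂ (inj₂ (1 , s≤s z≤n , cong suc (*-zeroʳ k) , *-zeroʳ k))
  InB-suc[k*i]-k*i (suc i) = inj₁ (i , suc k , s≤s z≤n ,
    trans (cong suc (k*[1+i]≡k*i+k i)) (sym (+-suc (k * i) k)) , k*[1+i]≡k*i+k i)

  InFac₂-φIter : ℕ → ℕ → Set
  InFac₂-φIter x y = ∃[ n ] Fac₂ (φIter k n) x y

  InFac₂-φIter-shift : ∀ {a b} → InFac₂-φIter a b → InFac₂-φIter (suc a) (φ-head b)
  InFac₂-φIter-shift (n , f) = suc n , fac₂-φ*⁺ (φIter k n) f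

  fac₂-φ⇒InFac₂-φIter : ∀ {a x y} → Fac₂ (φ k a) x y → InFac₂-φIter x y
  fac₂-φ⇒InFac₂-φIter {a} g = suc a , fac₂-φ*⁺-inner (n∈φIter-n a) g

  InB₂⇒InFac₂-φIter : ∀ {x y} → InB₂ k x y → InFac₂-φIter x y
  InB₂⇒InFac₂-φIter (i , suc j , _ , j+1≤k-1 , refl , refl) =
    fac₂-φ⇒InFac₂-φIter (subst (λ w → Fac₂ w (k * i) (k * i + suc j))
                               (sym (φ-low (m≤pred[n]⇒suc[m]≤n j+1≤k-1))) here)

  module _ (1<k : 1 < k) where

    InB-shift : ∀ {a b} → InB k a b → InB k (suc a) (φ-head b)
    InB-shift (inj₁ (i , a , _ , refl , refl)) =
      inj₁ (i , suc a , s≤s z≤n , sym (+-suc (k * i) a) , φ-head-k*i+k 1<k i)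
    InB-shift (inj₂ (inj₁ (i , b , _ , b≤k-1 , refl , refl)))
      with m≤n⇒m<n∨m≡n (m≤pred[n]⇒suc[m]≤n b≤k-1)
    ... | inj₁ b+1<k = subst (InB k (suc (k * i))) (sym (φ-head-low i b+1<k)) (InB-suc[k*i]-k*i i)
    ... | inj₂ b+1≡k = inj₁ (i , 1 , s≤s z≤n , +-comm 1 (k * i) , φ-head-top i b+1≡k)
    InB-shift (inj₂ (inj₂ (a , _ , refl , refl))) =
      inj₂ (inj₂ (suc a , s≤s z≤n , refl , φ-head-small 1<k))

    fac₂-φIter⇒InB : ∀ n {x y} → Fac₂ (φIter k n) x y → InB k x y
    fac₂-φIter⇒InB zero    (there ())
    fac₂-φIter⇒InB (suc n) f with fac₂-φ*⁻ (φIter k n) f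
    ... | inj₁ (_ , g)                   = inj₂ (inj₁ (fac₂-φ⇒InB₂ g))
    ... | inj₂ (_ , _ , g , refl , refl) = InB-shift (fac₂-φIter⇒InB n g)

    φIter-extends : ∀ n → ∃[ t ] φIter k (suc n) ≡ φIter k n ++ t × 1 ≤ length t
    φIter-extends zero    = 1 ∷ [] , trans (++-identityʳ (φ k 0)) (φ-small 1<k) , ≤-refl
    φIter-extends (suc n) with φIter-extends n
    ... | t , φIter≡ , 1≤t =
      φ* k t ,
      trans (cong (φ* k) φIter≡) (concatMap-++ (φ k) (φIter k n) t) ,
      ≤-trans 1≤t (length-φ* t)

    φIter-prefix : ∀ {m n} → m ≤′ n → ∃[ t ] φIter k n ≡ φIter k m ++ t
    φIter-prefix ≤′-refl = [] , sym (++-identityʳ _)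
    φIter-prefix {m} (≤′-step {n} m≤′n) with φIter-prefix m≤′n | φIter-extends n
    ... | t , φIter-n≡ | t′ , φIter-n+1≡ , _ =
      t ++ t′ , trans φIter-n+1≡ (trans (cong (_++ t′) φIter-n≡) (++-assoc (φIter k m) t t′))

    length-φIter : ∀ n → suc n ≤ length (φIter k n)
    length-φIter zero    = ≤-refl
    length-φIter (suc n) with φIter-extends n
    ... | t , φIter≡ , 1≤t = begin
      suc (suc n)                   ≡⟨ +-comm 1 (suc n) ⟩
      suc n + 1                     ≤⟨ +-mono-≤ (length-φIter n) 1≤t ⟩
      length (φIter k n) + length t ≡⟨ length-++ (φIter k n) ⟨
      length (φIter k n ++ t)       ≡⟨ cong length φIter≡ ⟨
      length (φIter k (suc n))      ∎
      where open ≤-Reasoning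

    nth-φIter-stable : ∀ {m n q} → m ≤ n → q < length (φIter k m) →
                       nth (φIter k n) q ≡ nth (φIter k m) q
    nth-φIter-stable {m} m≤n q<len with φIter-prefix (≤⇒≤′ m≤n)
    ... | t , φIter≡ = trans (cong (λ w → nth w _) φIter≡) (nth-++ˡ (φIter k m) t q<len)

    W-nth : ∀ n {q} → q < length (φIter k n) → W k q ≡ nth (φIter k n) q
    W-nth n {q} q<len with ≤-total n (suc q)
    ... | inj₁ n≤q+1 = nth-φIter-stable n≤q+1 q<len
    ... | inj₂ q+1≤n = sym (nth-φIter-stable q+1≤n (<-trans (n<1+n q) (length-φIter (suc q))))

    InFac₂⇔InFac₂-φIter : ∀ {x y} → InFac₂ k x y ⇔ InFac₂-φIter x y
    InFac₂⇔InFac₂-φIter = mk⇔ to from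
      where
      to : ∀ {x y} → InFac₂ k x y → InFac₂-φIter x y
      to (p , refl , refl) = suc p ,
        subst (Fac₂ (φIter k (suc p)) (W k p)) (sym (W-nth (suc p) (length-φIter (suc p))))
              (nth⇒fac₂ (φIter k (suc p)) p (length-φIter (suc p)))
      from : ∀ {x y} → InFac₂-φIter x y → InFac₂ k x y
      from (n , f) with fac₂⇒nth f
      ... | p , p+1<len , refl , refl = p , W-nth n (<-trans (n<1+n p) p+1<len) , W-nth n p+1<len

  -- The only use of k ≥ 3: (1.0) is the shift of (0.1) because φ(1) then starts with 0.
  module _ (2<k : 2 < k) where

    private
      1<k : 1 < k
      1<k = <-trans (n<1+n 1) 2<k

    InFac₂-φIter-0-1 : InFac₂-φIter 0 1
    InFac₂-φIter-0-1 =
      fac₂-φ⇒InFac₂-φIter (subst (λ w → Fac₂ w 0 1) (sym (φ-small 1<k)) here)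

    InFac₂-φIter-B₃ : ∀ a → InFac₂-φIter (suc a) 0
    InFac₂-φIter-B₃ zero    =
      subst (InFac₂-φIter 1) (φ-head-small 2<k) (InFac₂-φIter-shift InFac₂-φIter-0-1)
    InFac₂-φIter-B₃ (suc a) =
      subst (InFac₂-φIter (suc (suc a))) (φ-head-small 1<k)
            (InFac₂-φIter-shift (InFac₂-φIter-B₃ a))

    InFac₂-φIter-B₁ : ∀ i a → InFac₂-φIter (k * i + suc a) (k * i + k)
    InFac₂-φIter-B₁ i zero    =
      subst₂ InFac₂-φIter (+-comm 1 (k * i)) (φ-head-top i (suc-pred k))
        (InFac₂-φIter-shift (InB₂⇒InFac₂-φIter
          (i , pred k , suc[m]≤n⇒m≤pred[n] 1<k , ≤-refl , refl , refl)))
    InFac₂-φIter-B₁ i (suc a) =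
      subst₂ InFac₂-φIter (sym (+-suc (k * i) (suc a))) (φ-head-k*i+k 1<k i)
        (InFac₂-φIter-shift (InFac₂-φIter-B₁ i a))

    InB⇒InFac₂-φIter : ∀ {x y} → InB k x y → InFac₂-φIter x y
    InB⇒InFac₂-φIter (inj₁ (i , suc a , _ , refl , refl))    = InFac₂-φIter-B₁ i a
    InB⇒InFac₂-φIter (inj₂ (inj₁ xy∈B₂))                     = InB₂⇒InFac₂-φIter xy∈B₂
    InB⇒InFac₂-φIter (inj₂ (inj₂ (suc a , _ , refl , refl))) = InFac₂-φIter-B₃ a

theorem5p4 : (k : ℕ) → .{{_ : NonZero k}} → 3 ≤ k →
    (x y : ℕ) → InFac₂ k x y ⇔ InB k x y
theorem5p4 k k≥3 x y =
  ⇔-trans (InFac₂⇔InFac₂-φIter k 1<k)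
          (mk⇔ (λ (n , f) → fac₂-φIter⇒InB k 1<k n f) (InB⇒InFac₂-φIter k k≥3))
  where
  1<k : 1 < k
  1<k = <-trans (n<1+n 1) k≥3
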